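{- Let $\omega:\mathcal{X}\to\mathbb{R}$ be a model, and for a dataset $(\mathbf{x},y)\in\mathcal{X}^n\times\mathbb{R}^n$ index so that $(\omega(\mathbf{x}_1)-y_1)^2\le\dots\le(\omega(\mathbf{x}_n)-y_n)^2$. For $0\le\ell\le n$ define $\bar L^\ell(\mathbf{x},y)=\frac1n\sum_{i=1}^{n-\ell}(\omega(\mathbf{x}_i)-y_i)^2$. Then these are approximate lower output bounds for $\mathrm{MSE}_\omega$: $\bar L^\ell(\mathbf{x},y)\le L^\ell_{\mathrm{MSE}_\omega}(\mathbf{x},y)$ for all datasets and $\ell$, and $\bar L^\ell(\mathbf{x},y)\ge\bar L^{\ell+1}(\mathbf{x}',y')$ for all neighboring datasets.
   Context: $\mathrm{MSE}_\omega(\mathbf{x},y)=\frac1n\sum_{i=1}^n(\omega(\mathbf{x}_i)-y_i)^2$. $d_{\mathrm{ham}}((\mathbf{x},y),(\mathbf{x}',y'))=|\{i:\mathbf{x}_i\ne\mathbf{x}'_i\text{ or }y_i\ne y'_i\}|$; neighboring means distance $\le1$. $L^\ell_{\mathrm{MSE}_\omega}(\mathbf{x},y)=\inf\{\mathrm{MSE}_\omega(\mathbf{x}',y'):(\mathbf{x}',y')\in\mathcal{X}^n\times\mathbb{R}^n,\ d_{\mathrm{ham}}\le\ell\}$. -}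

module Defs where

open import Level using (Level; _⊔_) renaming (suc to lsuc)
open import Data.Nat as ℕ using (ℕ; _∸_; _<ᵇ_)
open import Data.Bool using (if_then_else_)
open import Data.Fin using (Fin; toℕ)
open import Data.Fin.Subset using (Subset; _∈_; ∣_∣)
open import Data.Fin.Permutation using (Permutation′; _⟨$⟩ʳ_)
open import Data.Product using (Σ; _×_)
open import Relation.Nullary using (¬_)
open import Relation.Binary.Core using (Rel)
open import Relation.Binary.Structures using (IsTotalOrder)
open import Relation.Binary.PropositionalEquality using (_≡_)
open import Algebra.Bundles using (CommutativeRing)
import Algebra.Definitions.RawMonoid as RawMonoidDefs

-- An ordered field (ℝ is an instance).  The inverse is a total operation
-- whose only law concerns nonzero arguments (its value at 0 is irrelevant).
record OrderedField (c ℓ₁ ℓ₂ : Level) : Set (lsuc (c ⊔ ℓ₁ ⊔ ℓ₂)) where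
  field
    commutativeRing : CommutativeRing c ℓ₁
  open CommutativeRing commutativeRing public
  field
    _≤_          : Rel Carrier ℓ₂
    isTotalOrder : IsTotalOrder _≈_ _≤_
    0≉1          : ¬ (0# ≈ 1#)
    +-monoˡ-≤    : ∀ {a b} c → a ≤ b → (a + c) ≤ (b + c)
    *-nonneg     : ∀ {a b} → 0# ≤ a → 0# ≤ b → 0# ≤ (a * b)
    _⁻¹          : Carrier → Carrier
    ⁻¹-inverse   : ∀ x → ¬ (x ≈ 0#) → (x * (x ⁻¹)) ≈ 1#

module Regression {c ℓ₁ ℓ₂ : Level} (F : OrderedField c ℓ₁ ℓ₂) where
  open OrderedField F
  open RawMonoidDefs +-rawMonoid using (sum) renaming (_×_ to _·_)

  ⟦_⟧ : ℕ → Carrier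
  ⟦ n ⟧ = n · 1#

  sq : Carrier → Carrier
  sq a = a * a

  err : {X : Set} (ω : X → Carrier) {n : ℕ} → (Fin n → X) → (Fin n → Carrier) → Fin n → Carrier
  err ω x y i = sq (ω (x i) - y i)

  MSE : {X : Set} (ω : X → Carrier) {n : ℕ} → (Fin n → X) → (Fin n → Carrier) → Carrier
  MSE ω {n} x y = (⟦ n ⟧ ⁻¹) * sum (err ω x y)

  SortsErrors : {X : Set} (ω : X → Carrier) {n : ℕ} → (Fin n → X) → (Fin n → Carrier) → Permutation′ n → Set ℓ₂
  SortsErrors ω x y σ = ∀ i j → toℕ i ℕ.≤ toℕ j → err ω x y (σ ⟨$⟩ʳ i) ≤ err ω x y (σ ⟨$⟩ʳ j)

  Lbar : {X : Set} (ω : X → Carrier) {n : ℕ} → (Fin n → X) → (Fin n → Carrier) → Permutation′ n → ℕ → Carrier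
  Lbar ω {n} x y σ ℓ =
    (⟦ n ⟧ ⁻¹) * sum (λ i → if toℕ i <ᵇ (n ∸ ℓ) then err ω x y (σ ⟨$⟩ʳ i) else 0#)

  -- d_ham((x,y),(x',y')) ≤ k : all disagreeing positions lie in a set of size ≤ k
  HamLe : {X : Set} {n : ℕ} → ℕ → (Fin n → X) → (Fin n → Carrier) → (Fin n → X) → (Fin n → Carrier) → Set ℓ₁
  HamLe {X} {n} k x y x' y' =
    Σ (Subset n) λ S → (∣ S ∣ ℕ.≤ k) × (∀ i → ¬ (i ∈ S) → (x i ≡ x' i) × (y i ≈ y' i))

{-# OPTIONS --safe #-}
module Submission where

-- Let S be the at most ℓ positions where (x, y) and (x', y') differ.  Any selection of
-- n − ℓ indices outside S has the same squared errors in both datasets, and since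
-- errors are nonnegative, the n − ℓ smallest errors of (x, y) sum to at most the errors
-- over that selection, hence at most the total error of (x', y').  For (2) select the
-- n − ℓ indices of smallest error of (x, y): all but at most one lie outside S, so they
-- dominate the n − ℓ − 1 smallest errors of (x', y').

open import Defs
open import Level using (Level)
open import Data.Nat as ℕ using (ℕ; zero; suc; _∸_; _<ᵇ_; z≤n; s≤s)
import Data.Nat.Properties as ℕₚ
open import Data.Fin using (Fin; toℕ) renaming (zero to fzero; suc to fsuc)
open import Data.Fin.Subset using (Subset; _∈_; ∣_∣)
open import Data.Fin.Permutation using (Permutation′; _⟨$⟩ʳ_; _⟨$⟩ˡ_; inverseˡ; flip)
open import Data.Bool using (Bool; true; false; T; if_then_else_; not; _∧_)
open import Data.Bool.Properties using (T-∧)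
open import Data.Empty using (⊥-elim)
open import Data.Product using (_×_; _,_; proj₁; proj₂)
open import Data.Sum using (inj₁; inj₂)
open import Data.Vec using ([]; _∷_; lookup)
open import Data.Vec.Properties using ([]=⇒lookup)
open import Function using (_∘_; Equivalence)
open import Relation.Nullary using (¬_)
open import Relation.Binary.PropositionalEquality as ≡ using (_≡_)
open import Relation.Binary.Bundles using (Poset)
open import Relation.Binary.Structures using (IsTotalOrder)
import Algebra.Definitions.RawMonoid as RawMonoidDefs
import Algebra.Properties.CommutativeMonoid.Sum as CommutativeMonoidSum
import Algebra.Properties.Ring as RingProperties
import Relation.Binary.Reasoning.PartialOrder as ≤-Reasoning

private module Count = CommutativeMonoidSum ℕₚ.+-0-commutativeMonoid

count : ∀ {n} → (Fin n → Bool) → ℕ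
count p = Count.sum (λ i → if p i then 1 else 0)

count-permute : ∀ {n} (p : Fin n → Bool) (π : Permutation′ n) → count p ≡ count (p ∘ (π ⟨$⟩ʳ_))
count-permute p = Count.sum-permute (λ i → if p i then 1 else 0)

count≤n : ∀ {n} (p : Fin n → Bool) → count p ℕ.≤ n
count≤n {zero}  p = z≤n
count≤n {suc n} p with p fzero
... | true  = s≤s (count≤n (p ∘ fsuc))
... | false = ℕₚ.m≤n⇒m≤1+n (count≤n (p ∘ fsuc))

count-<ᵇ : ∀ {n} m → m ℕ.≤ n → count {n} (λ i → toℕ i <ᵇ m) ≡ m
count-<ᵇ {n}     zero    _         = Count.sum-replicate-zero n
count-<ᵇ {suc n} (suc m) (s≤s m≤n) = ≡.cong suc (count-<ᵇ m m≤n)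

rankBelow : ∀ {n} → Permutation′ n → ℕ → Fin n → Bool
rankBelow σ m j = toℕ (σ ⟨$⟩ˡ j) <ᵇ m

count-rankBelow : ∀ {n} (σ : Permutation′ n) {m} → m ℕ.≤ n → count (rankBelow σ m) ≡ m
count-rankBelow σ {m} m≤n = ≡.trans (≡.sym (count-permute (λ i → toℕ i <ᵇ m) (flip σ))) (count-<ᵇ m m≤n)

count-true : ∀ {n} → count {n} (λ _ → true) ≡ n
count-true {zero}  = ≡.refl
count-true {suc n} = ≡.cong suc (count-true {n})

count-lookup : ∀ {n} (S : Subset n) → count (lookup S) ≡ ∣ S ∣
count-lookup []          = ≡.refl
count-lookup (true ∷ S)  = ≡.cong suc (count-lookup S)
count-lookup (false ∷ S) = count-lookup S

count≤count+count-∧-not : ∀ {n} (q p : Fin n → Bool) →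
                          count p ℕ.≤ count q ℕ.+ count (λ i → not (q i) ∧ p i)
count≤count+count-∧-not {zero}  q p = z≤n
count≤count+count-∧-not {suc n} q p with q fzero | p fzero | count≤count+count-∧-not (q ∘ fsuc) (p ∘ fsuc)
... | true  | true  | rest = s≤s rest
... | true  | false | rest = ℕₚ.m≤n⇒m≤1+n rest
... | false | true  | rest = ≡.subst (suc (count (p ∘ fsuc)) ℕ.≤_) (≡.sym (ℕₚ.+-suc _ _)) (s≤s rest)
... | false | false | rest = rest

count-∸-≤-count-∧-not : ∀ {n} (q p : Fin n → Bool) →
                        count p ∸ count q ℕ.≤ count (λ i → not (q i) ∧ p i)
count-∸-≤-count-∧-not q p = ℕₚ.m≤n+o⇒m∸n≤o (count p) (count q) (count≤count+count-∧-not q p)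

module OrderedFieldProperties {c ℓ₁ ℓ₂ : Level} (F : OrderedField c ℓ₁ ℓ₂) where
  open OrderedField F public renaming (_≤_ to infix 4 _≤_)
  open RawMonoidDefs +-rawMonoid using (sum) renaming (_×_ to _·_)
  open IsTotalOrder isTotalOrder public
    using (total; antisym) renaming (reflexive to ≤-reflexive; trans to ≤-trans; ≲-respʳ-≈ to ≤-respʳ-≈; ≲-respˡ-≈ to ≤-respˡ-≈)
  private module Ring = RingProperties ring

  poset : Poset c ℓ₁ ℓ₂
  poset = record { isPartialOrder = IsTotalOrder.isPartialOrder isTotalOrder }

  ≤-refl : ∀ {a} → a ≤ a
  ≤-refl = ≤-reflexive refl

  +-mono-≤ : ∀ {a b c d} → a ≤ b → c ≤ d → a + c ≤ b + d
  +-mono-≤ {a} {b} {c} {d} a≤b c≤d =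
    ≤-trans (+-monoˡ-≤ c a≤b) (≤-respˡ-≈ (+-comm c b) (≤-respʳ-≈ (+-comm d b) (+-monoˡ-≤ b c≤d)))

  0≤x*x : ∀ a → 0# ≤ a * a
  0≤x*x a with total 0# a
  ... | inj₁ 0≤a = *-nonneg 0≤a 0≤a
  ... | inj₂ a≤0 = ≤-respʳ-≈ -a*-a≈a*a (*-nonneg 0≤-a 0≤-a)
    where
    0≤-a : 0# ≤ - a
    0≤-a = ≤-respˡ-≈ (-‿inverseʳ a) (≤-respʳ-≈ (+-identityˡ (- a)) (+-monoˡ-≤ (- a) a≤0))
    -a*-a≈a*a : - a * - a ≈ a * a
    -a*-a≈a*a = trans (sym (Ring.-‿distribˡ-* a (- a)))
                      (trans (-‿cong (sym (Ring.-‿distribʳ-* a a))) (Ring.-‿involutive (a * a)))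

  0≤1 : 0# ≤ 1#
  0≤1 = ≤-respʳ-≈ (*-identityˡ 1#) (0≤x*x 1#)

  0≤⟦n⟧ : ∀ n → 0# ≤ n · 1#
  0≤⟦n⟧ zero    = ≤-refl
  0≤⟦n⟧ (suc n) = ≤-respˡ-≈ (+-identityˡ 0#) (+-mono-≤ 0≤1 (0≤⟦n⟧ n))

  ⟦1+n⟧≉0 : ∀ n → ¬ (suc n · 1# ≈ 0#)
  ⟦1+n⟧≉0 n eq = 0≉1 (antisym 0≤1 (≤-respʳ-≈ eq 1≤⟦1+n⟧))
    where
    1≤⟦1+n⟧ : 1# ≤ suc n · 1#
    1≤⟦1+n⟧ = ≤-respˡ-≈ (+-identityˡ 1#) (≤-respʳ-≈ (+-comm (n · 1#) 1#) (+-monoˡ-≤ 1# (0≤⟦n⟧ n)))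

  0≤⟦1+n⟧⁻¹ : ∀ n → 0# ≤ (suc n · 1#) ⁻¹
  0≤⟦1+n⟧⁻¹ n = ≤-respʳ-≈ x*x⁻¹*x⁻¹≈x⁻¹ (*-nonneg (0≤⟦n⟧ (suc n)) (0≤x*x (x ⁻¹)))
    where
    x = suc n · 1#
    x*x⁻¹*x⁻¹≈x⁻¹ : x * (x ⁻¹ * x ⁻¹) ≈ x ⁻¹
    x*x⁻¹*x⁻¹≈x⁻¹ = trans (sym (*-assoc x (x ⁻¹) (x ⁻¹)))
                          (trans (*-cong (⁻¹-inverse x (⟦1+n⟧≉0 n)) refl) (*-identityˡ (x ⁻¹)))

  *-monoʳ-≤-nonneg : ∀ {c a b} → 0# ≤ c → a ≤ b → c * a ≤ c * b
  *-monoʳ-≤-nonneg {c} {a} {b} 0≤c a≤b =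
    ≤-respˡ-≈ (+-identityˡ (c * a)) (≤-respʳ-≈ c*[b-a]+c*a≈c*b (+-monoˡ-≤ (c * a) (*-nonneg 0≤c 0≤b-a)))
    where
    0≤b-a : 0# ≤ b - a
    0≤b-a = ≤-respˡ-≈ (-‿inverseʳ a) (+-monoˡ-≤ (- a) a≤b)
    c*[b-a]+c*a≈c*b : c * (b - a) + c * a ≈ c * b
    c*[b-a]+c*a≈c*b = trans (sym (distribˡ c (b - a) a))
      (*-cong refl (trans (+-assoc b (- a) a) (trans (+-cong refl (-‿inverseˡ a)) (+-identityʳ b))))

  sum-mono-≤ : ∀ {n} {f g : Fin n → Carrier} → (∀ i → f i ≤ g i) → sum f ≤ sum g
  sum-mono-≤ {zero}  f≤g = ≤-refl
  sum-mono-≤ {suc n} f≤g = +-mono-≤ (f≤g fzero) (sum-mono-≤ (f≤g ∘ fsuc))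

module SelectionSums {c ℓ₁ ℓ₂ : Level} (F : OrderedField c ℓ₁ ℓ₂) where
  open OrderedFieldProperties F
  open RawMonoidDefs +-rawMonoid using (sum)
  open ≤-Reasoning poset
  private module Sum = CommutativeMonoidSum +-commutativeMonoid

  sumWhere : ∀ {n} → (Fin n → Bool) → (Fin n → Carrier) → Carrier
  sumWhere p f = sum (λ i → if p i then f i else 0#)

  prefixSum : ∀ {n} → ℕ → (Fin n → Carrier) → Carrier
  prefixSum k = sumWhere (λ i → toℕ i <ᵇ k)

  NonNegative : ∀ {n} → (Fin n → Carrier) → Set ℓ₂
  NonNegative f = ∀ i → 0# ≤ f i

  NonDecreasing : ∀ {n} → (Fin n → Carrier) → Set ℓ₂
  NonDecreasing f = ∀ i j → toℕ i ℕ.≤ toℕ j → f i ≤ f j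

  NonDecreasing-tail : ∀ {n} {f : Fin (suc n) → Carrier} → NonDecreasing f → NonDecreasing (f ∘ fsuc)
  NonDecreasing-tail mono i j i≤j = mono (fsuc i) (fsuc j) (s≤s i≤j)

  sumWhere-permute : ∀ {n} p f (π : Permutation′ n) →
                     sumWhere p f ≈ sumWhere (p ∘ (π ⟨$⟩ʳ_)) (f ∘ (π ⟨$⟩ʳ_))
  sumWhere-permute p f = Sum.sum-permute (λ i → if p i then f i else 0#)

  sumWhere-cong-≗ : ∀ {n} {p q : Fin n → Bool} f → (∀ i → p i ≡ q i) → sumWhere p f ≡ sumWhere q f
  sumWhere-cong-≗ f p≗q = Sum.sum-cong-≗ (λ i → ≡.cong (λ b → if b then f i else 0#) (p≗q i))

  sumWhere-congOn : ∀ {n} (p : Fin n → Bool) {f g} → (∀ i → T (p i) → f i ≈ g i) → sumWhere p f ≈ sumWhere p g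
  sumWhere-congOn p {f} {g} f≈g = Sum.sum-cong-≋ pointwise
    where
    pointwise : ∀ i → (if p i then f i else 0#) ≈ (if p i then g i else 0#)
    pointwise i with p i | f≈g i
    ... | true  | f≈gᵢ = f≈gᵢ _
    ... | false | _    = refl

  sumWhere-nonneg : ∀ {n} (p : Fin n → Bool) {f} → NonNegative f → 0# ≤ sumWhere p f
  sumWhere-nonneg {zero}  p 0≤f = ≤-refl
  sumWhere-nonneg {suc n} p 0≤f =
    ≤-respˡ-≈ (+-identityˡ 0#) (+-mono-≤ head (sumWhere-nonneg (p ∘ fsuc) (0≤f ∘ fsuc)))
    where
    head : 0# ≤ (if p fzero then _ else 0#)
    head with p fzero
    ... | true  = 0≤f fzero
    ... | false = ≤-refl

  sumWhere-mono-⇒ : ∀ {n} {p q : Fin n → Bool} {f} → NonNegative f → (∀ i → T (p i) → T (q i)) →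
                    sumWhere p f ≤ sumWhere q f
  sumWhere-mono-⇒ {p = p} {q} {f} 0≤f p⇒q = sum-mono-≤ pointwise
    where
    pointwise : ∀ i → (if p i then f i else 0#) ≤ (if q i then f i else 0#)
    pointwise i with p i | q i | p⇒q i
    ... | true  | true  | _   = ≤-refl
    ... | true  | false | p⇒q = ⊥-elim (p⇒q _)
    ... | false | true  | _   = 0≤f i
    ... | false | false | _   = ≤-refl

  sumWhere-rankBelow : ∀ {n} (σ : Permutation′ n) m f → sumWhere (rankBelow σ m) f ≈ prefixSum m (f ∘ (σ ⟨$⟩ʳ_))
  sumWhere-rankBelow σ m f = trans (sumWhere-permute (rankBelow σ m) f σ)
    (reflexive (sumWhere-cong-≗ (f ∘ (σ ⟨$⟩ʳ_)) (λ i → ≡.cong (λ j → toℕ j <ᵇ m) (inverseˡ σ))))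

  prefixSum-zero : ∀ {n} (f : Fin n → Carrier) → prefixSum 0 f ≈ 0#
  prefixSum-zero {n} f = Sum.sum-replicate-zero n

  prefixSum-shift : ∀ {n} {f : Fin (suc n) → Carrier} → NonDecreasing f →
                    ∀ {k} → k ℕ.≤ n → prefixSum k f ≤ prefixSum k (f ∘ fsuc)
  prefixSum-shift {f = f} _ {zero} _ = ≤-reflexive (trans (prefixSum-zero f) (sym (prefixSum-zero (f ∘ fsuc))))
  prefixSum-shift {suc n} mono {suc k} (s≤s k≤n) =
    +-mono-≤ (mono fzero (fsuc fzero) z≤n) (prefixSum-shift (NonDecreasing-tail mono) k≤n)

  prefixSum≤sumWhere : ∀ {n} {f : Fin n → Carrier} → NonDecreasing f → NonNegative f →
                       ∀ p {k} → k ℕ.≤ count p → prefixSum k f ≤ sumWhere p f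
  prefixSum≤sumWhere {f = f} _ 0≤f p {zero} _ = ≤-respˡ-≈ (sym (prefixSum-zero f)) (sumWhere-nonneg p 0≤f)
  prefixSum≤sumWhere {suc n} {f} mono 0≤f p {suc k} 1+k≤count with p fzero | 1+k≤count
  ... | true  | s≤s k≤count =
    +-mono-≤ ≤-refl (prefixSum≤sumWhere (NonDecreasing-tail mono) (0≤f ∘ fsuc) (p ∘ fsuc) k≤count)
  ... | false | 1+k≤count = begin
    prefixSum (suc k) f                        ≤⟨ prefixSum-shift mono (ℕₚ.≤-trans 1+k≤count (count≤n (p ∘ fsuc))) ⟩
    prefixSum (suc k) (f ∘ fsuc)               ≤⟨ prefixSum≤sumWhere (NonDecreasing-tail mono) (0≤f ∘ fsuc) (p ∘ fsuc) 1+k≤count ⟩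
    sumWhere (p ∘ fsuc) (f ∘ fsuc)             ≈⟨ +-identityˡ _ ⟨
    0# + sumWhere (p ∘ fsuc) (f ∘ fsuc)        ∎

  prefixSum≤sumWhere-agreeOutside : ∀ {n} {e e' : Fin n → Carrier} (σ : Permutation′ n) →
    NonDecreasing (e ∘ (σ ⟨$⟩ʳ_)) → NonNegative e → NonNegative e' →
    (S : Subset n) → (∀ i → ¬ i ∈ S → e i ≈ e' i) →
    ∀ p {k} → k ℕ.≤ count p ∸ ∣ S ∣ → prefixSum k (e ∘ (σ ⟨$⟩ʳ_)) ≤ sumWhere p e'
  prefixSum≤sumWhere-agreeOutside {e = e} {e'} σ sorted 0≤e 0≤e' S e≈e' p {k} k≤ = begin
    prefixSum k (e ∘ (σ ⟨$⟩ʳ_))                  ≤⟨ prefixSum≤sumWhere sorted (0≤e ∘ (σ ⟨$⟩ʳ_)) (outside ∘ (σ ⟨$⟩ʳ_)) k≤count ⟩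
    sumWhere (outside ∘ (σ ⟨$⟩ʳ_)) (e ∘ (σ ⟨$⟩ʳ_)) ≈⟨ sumWhere-permute outside e σ ⟨
    sumWhere outside e                           ≈⟨ sumWhere-congOn outside (λ i i∉S∧p → e≈e' i (not-lookup⇒∉ (proj₁ (∧-elim i∉S∧p)))) ⟩
    sumWhere outside e'                          ≤⟨ sumWhere-mono-⇒ 0≤e' (λ i i∉S∧p → proj₂ (∧-elim i∉S∧p)) ⟩
    sumWhere p e'                                ∎
    where
    outside : Fin _ → Bool
    outside i = not (lookup S i) ∧ p i
    ∧-elim : ∀ {a b} → T (a ∧ b) → T a × T b
    ∧-elim = Equivalence.to T-∧
    not-lookup⇒∉ : ∀ {i} → T (not (lookup S i)) → ¬ i ∈ S
    not-lookup⇒∉ i∉S i∈S = ≡.subst (T ∘ not) ([]=⇒lookup i∈S) i∉S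
    k≤count : k ℕ.≤ count (outside ∘ (σ ⟨$⟩ʳ_))
    k≤count = ℕₚ.≤-trans k≤ (ℕₚ.≤-trans
      (ℕₚ.≤-reflexive (≡.cong (count p ∸_) (≡.sym (count-lookup S))))
      (ℕₚ.≤-trans (count-∸-≤-count-∧-not (lookup S) p) (ℕₚ.≤-reflexive (count-permute outside σ))))

module RegressionBounds {c ℓ₁ ℓ₂ : Level} (F : OrderedField c ℓ₁ ℓ₂) {X : Set} (ω : X → OrderedField.Carrier F) where
  open OrderedFieldProperties F
  open SelectionSums F
  open Regression F
  open RawMonoidDefs +-rawMonoid using (sum)
  open ≤-Reasoning poset

  err-nonneg : ∀ {n} (x : Fin n → X) y → NonNegative (err ω x y)
  err-nonneg x y i = 0≤x*x _

  err-agree : ∀ {n} {x x' : Fin n → X} {y y'} {S : Subset n} → (∀ i → ¬ i ∈ S → (x i ≡ x' i) × (y i ≈ y' i)) →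
              ∀ i → ¬ i ∈ S → err ω x y i ≈ err ω x' y' i
  err-agree agree i i∉S = *-cong difference difference
    where
    difference = +-cong (reflexive (≡.cong ω (proj₁ (agree i i∉S)))) (-‿cong (proj₂ (agree i i∉S)))

  -- 0⁻¹ may be negative, but for n = 0 both sums are empty.
  ⟦n⟧⁻¹*-mono : ∀ n {f g : Fin n → Carrier} → sum f ≤ sum g → ⟦ n ⟧ ⁻¹ * sum f ≤ ⟦ n ⟧ ⁻¹ * sum g
  ⟦n⟧⁻¹*-mono zero     _   = ≤-refl
  ⟦n⟧⁻¹*-mono (suc n) f≤g = *-monoʳ-≤-nonneg (0≤⟦1+n⟧⁻¹ n) f≤g

  Lbar≤MSE : ∀ {n} (x : Fin n → X) y σ ℓ → SortsErrors ω x y σ →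
             ∀ x' y' → HamLe ℓ x y x' y' → Lbar ω x y σ ℓ ≤ MSE ω x' y'
  Lbar≤MSE {n} x y σ ℓ sorted x' y' (S , ∣S∣≤ℓ , agree) = ⟦n⟧⁻¹*-mono n
    (prefixSum≤sumWhere-agreeOutside σ sorted (err-nonneg x y) (err-nonneg x' y') S
      (err-agree agree) (λ _ → true) (ℕₚ.∸-mono (ℕₚ.≤-reflexive (≡.sym count-true)) ∣S∣≤ℓ))

  Lbar-neighbour : ∀ {n} (x : Fin n → X) y σ x' y' σ' ℓ → SortsErrors ω x' y' σ' →
                   HamLe 1 x y x' y' → Lbar ω x' y' σ' (ℓ ℕ.+ 1) ≤ Lbar ω x y σ ℓ
  Lbar-neighbour {n} x y σ x' y' σ' ℓ sorted' (S , ∣S∣≤1 , agree) = ⟦n⟧⁻¹*-mono n (begin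
    prefixSum (n ∸ (ℓ ℕ.+ 1)) (err ω x' y' ∘ (σ' ⟨$⟩ʳ_))
      ≤⟨ prefixSum≤sumWhere-agreeOutside σ' sorted' (err-nonneg x' y') (err-nonneg x y) S
           (λ i i∉S → sym (err-agree agree i i∉S)) (rankBelow σ (n ∸ ℓ)) bound ⟩
    sumWhere (rankBelow σ (n ∸ ℓ)) (err ω x y)
      ≈⟨ sumWhere-rankBelow σ (n ∸ ℓ) (err ω x y) ⟩
    prefixSum (n ∸ ℓ) (err ω x y ∘ (σ ⟨$⟩ʳ_)) ∎)
    where
    bound : n ∸ (ℓ ℕ.+ 1) ℕ.≤ count (rankBelow σ (n ∸ ℓ)) ∸ ∣ S ∣
    bound = ≡.subst (ℕ._≤ count (rankBelow σ (n ∸ ℓ)) ∸ ∣ S ∣) (ℕₚ.∸-+-assoc n ℓ 1)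
      (ℕₚ.∸-mono (ℕₚ.≤-reflexive (≡.sym (count-rankBelow σ (ℕₚ.m∸n≤m n ℓ)))) ∣S∣≤1)

-- Imported only now because inside the modules above _≤_ and _+_ are the field's.
open import Data.Nat using (_≤_; _+_)

lemmaD8 : {c ℓ₁ ℓ₂ : Level} (F : OrderedField c ℓ₁ ℓ₂) (X : Set) (ω : X → OrderedField.Carrier F) (n : ℕ) →
    -- (1) L̄^ℓ(x,y) ≤ L^ℓ_MSE(x,y) = inf of MSE over datasets at Hamming distance ≤ ℓ
    ((x : Fin n → X) (y : Fin n → OrderedField.Carrier F) (σ : Permutation′ n) (ℓ : ℕ) → ℓ ≤ n →
    Regression.SortsErrors F ω x y σ →
    (x' : Fin n → X) (y' : Fin n → OrderedField.Carrier F) → Regression.HamLe F ℓ x y x' y' →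
    OrderedField._≤_ F (Regression.Lbar F ω x y σ ℓ) (Regression.MSE F ω x' y'))
    ×
    -- (2) L̄^ℓ(x,y) ≥ L̄^{ℓ+1}(x',y') for neighbouring datasets
    ((x : Fin n → X) (y : Fin n → OrderedField.Carrier F) (σ : Permutation′ n)
    (x' : Fin n → X) (y' : Fin n → OrderedField.Carrier F) (σ' : Permutation′ n) (ℓ : ℕ) → ℓ + 1 ≤ n →
    Regression.SortsErrors F ω x y σ → Regression.SortsErrors F ω x' y' σ' →
    Regression.HamLe F 1 x y x' y' →
    OrderedField._≤_ F (Regression.Lbar F ω x' y' σ' (ℓ + 1)) (Regression.Lbar F ω x y σ ℓ))
lemmaD8 F X ω n = (λ x y σ ℓ _ → Lbar≤MSE x y σ ℓ) , (λ x y σ x' y' σ' ℓ _ _ → Lbar-neighbour x y σ x' y' σ' ℓ)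
  where open RegressionBounds F ω
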